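{- Let $R$ be a (not necessarily commutative) ring with identity $1$, i.e. $1\cdot x=x\cdot 1=x$ for all $x\in R$. For $x\in R$, there is at most one $y\in R$ such that $x\cdot x\cdot y=x$, $y\cdot y\cdot x=y$, $x\cdot y\cdot y=y$, and $y\cdot x\cdot x=x$. -}

module Defs where

-- The
-- equations y·y·x = y and x·y·y = y force x and y to commute; with that,
-- y·x·x = x and x·y·y = y say that y is the group inverse of x (x·y·x = x,
-- y·x·y = y, x·y = y·x), and a group inverse is unique.
module Submission where

open import Defs
open import Level using (Level)
open import Algebra.Bundles using (Semigroup; Ring)
import Relation.Binary.Reasoning.Setoid as ≈-Reasoning

module GroupInverse {c ℓ : Level} (S : Semigroup c ℓ) where
  open Semigroup S
  open ≈-Reasoning setoid

  record IsGroupInverse (x y : Carrier) : Set ℓ where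
    field
      commute : x ∙ y ≈ y ∙ x
      inner   : x ∙ y ∙ x ≈ x
      outer   : y ∙ x ∙ y ≈ y

  commute-if-absorbing : ∀ x y → y ∙ y ∙ x ≈ y → x ∙ y ∙ y ≈ y → x ∙ y ≈ y ∙ x
  commute-if-absorbing x y yyx≈y xyy≈y = begin
    x ∙ y             ≈⟨ ∙-congˡ (sym yyx≈y) ⟩
    x ∙ (y ∙ y ∙ x)   ≈⟨ sym (assoc x (y ∙ y) x) ⟩
    x ∙ (y ∙ y) ∙ x   ≈⟨ ∙-congʳ (sym (assoc x y y)) ⟩
    x ∙ y ∙ y ∙ x     ≈⟨ ∙-congʳ xyy≈y ⟩
    y ∙ x             ∎

  isGroupInverse : ∀ x y → y ∙ y ∙ x ≈ y → x ∙ y ∙ y ≈ y → y ∙ x ∙ x ≈ x →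
                   IsGroupInverse x y
  isGroupInverse x y yyx≈y xyy≈y yxx≈x = record
    { commute = xy≈yx
    ; inner   = trans (∙-congʳ xy≈yx) yxx≈x
    ; outer   = trans (∙-congʳ (sym xy≈yx)) xyy≈y
    }
    where
    xy≈yx : x ∙ y ≈ y ∙ x
    xy≈yx = commute-if-absorbing x y yyx≈y xyy≈y

  -- Both x·y and x·z equal (x·z)·(x·y), once by x·z·x = x and once by x·y·x = x.
  groupInverse-idempotent-unique : ∀ {x y z} → IsGroupInverse x y → IsGroupInverse x z →
                                   x ∙ y ≈ x ∙ z
  groupInverse-idempotent-unique {x} {y} {z} y⁻ z⁻ = begin
    x ∙ y               ≈⟨ ∙-congʳ (sym (IsGroupInverse.inner z⁻)) ⟩
    x ∙ z ∙ x ∙ y       ≈⟨ assoc (x ∙ z) x y ⟩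
    (x ∙ z) ∙ (x ∙ y)   ≈⟨ ∙-cong (IsGroupInverse.commute z⁻) (IsGroupInverse.commute y⁻) ⟩
    (z ∙ x) ∙ (y ∙ x)   ≈⟨ assoc z x (y ∙ x) ⟩
    z ∙ (x ∙ (y ∙ x))   ≈⟨ ∙-congˡ (sym (assoc x y x)) ⟩
    z ∙ (x ∙ y ∙ x)     ≈⟨ ∙-congˡ (IsGroupInverse.inner y⁻) ⟩
    z ∙ x               ≈⟨ sym (IsGroupInverse.commute z⁻) ⟩
    x ∙ z               ∎

  groupInverse-unique : ∀ {x y z} → IsGroupInverse x y → IsGroupInverse x z → y ≈ z
  groupInverse-unique {x} {y} {z} y⁻ z⁻ = begin
    y             ≈⟨ sym (IsGroupInverse.outer y⁻) ⟩
    y ∙ x ∙ y     ≈⟨ assoc y x y ⟩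
    y ∙ (x ∙ y)   ≈⟨ ∙-congˡ xy≈xz ⟩
    y ∙ (x ∙ z)   ≈⟨ sym (assoc y x z) ⟩
    y ∙ x ∙ z     ≈⟨ ∙-congʳ (sym (IsGroupInverse.commute y⁻)) ⟩
    x ∙ y ∙ z     ≈⟨ ∙-congʳ xy≈xz ⟩
    x ∙ z ∙ z     ≈⟨ ∙-congʳ (IsGroupInverse.commute z⁻) ⟩
    z ∙ x ∙ z     ≈⟨ IsGroupInverse.outer z⁻ ⟩
    z             ∎
    where
    xy≈xz : x ∙ y ≈ x ∙ z
    xy≈xz = groupInverse-idempotent-unique y⁻ z⁻

mainTheorem14 : ∀ {c ℓ : Level} (R : Ring c ℓ) → let open Ring R in
    ∀ (x y z : Carrier) →
    x * x * y ≈ x → y * y * x ≈ y → x * y * y ≈ y → y * x * x ≈ x →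
    x * x * z ≈ x → z * z * x ≈ z → x * z * z ≈ z → z * x * x ≈ x →
    y ≈ z
mainTheorem14 R x y z _ yyx≈y xyy≈y yxx≈x _ zzx≈z xzz≈z zxx≈x =
  groupInverse-unique (isGroupInverse x y yyx≈y xyy≈y yxx≈x)
                      (isGroupInverse x z zzx≈z xzz≈z zxx≈x)
  where open GroupInverse (Ring.*-semigroup R)
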